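{- For every integer $n\ge1$, $$\left\lfloor\left(\sum_{k=n}^\infty\frac{(-1)^k}{B_{2k}}\right)^{ -1}\right\rfloor=\begin{cases}B_{2n}+B_{2n-2}&\text{if $n$ is even},\\ -(B_{2n}+B_{2n-2}+1)&\text{if $n$ is odd}.\end{cases}$$
   Context: The balancing numbers are defined by $B_0=0$, $B_1=1$, $B_n=6B_{n-1}-B_{n-2}$ for $n\ge 2$. $\lfloor x\rfloor$ denotes the floor of a real number $x$. -}

module Defs where

open import Data.Nat as ℕ using (ℕ; zero; suc)
open import Data.Integer as ℤ using (ℤ; +_)
open import Data.Rational using (ℚ; _/_; _+_; _*_; _-_; -_; _≤_; _<_; ∣_∣; 0ℚ; 1ℚ)
open import Data.Product using (Σ; _×_; ∃)

B : ℕ → ℤ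
B zero = + 0
B (suc zero) = + 1
B (suc (suc n)) = (+ 6) ℤ.* B (suc n) ℤ.- B n

ι : ℤ → ℚ
ι z = z / 1

sgn : ℕ → ℚ
sgn zero = 1ℚ
sgn (suc k) = - sgn k

-- 1/d for a natural number d; the value at d = 0 is an irrelevant convention
-- (only used for d = B (2k) with k ≥ 1, which is ≥ 1).
recip : ℕ → ℚ
recip zero = 0ℚ
recip (suc d) = (+ 1) / suc d

-- the k-th term (-1)^k / B_{2k}   (B_{2k} ≥ 0, so ∣ B (2k) ∣ = B (2k))
term : ℕ → ℚ
term k = sgn k * recip (ℤ.∣ B (2 ℕ.* k) ∣)

-- partial sums: tailSum n N = Σ_{k = n}^{n + N} term k
tailSum : ℕ → ℕ → ℚ
tailSum n zero = term n
tailSum n (suc N) = tailSum n N + term (n ℕ.+ suc N)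

-- A rational sequence is Cauchy (so it converges to a real number).
Cauchy : (ℕ → ℚ) → Set
Cauchy u = ∀ (ε : ℚ) → 0ℚ < ε → ∃ λ N → ∀ i j → N ℕ.≤ i → N ℕ.≤ j → ∣ u i - u j ∣ ≤ ε

-- the limit of u is ≥ 0
LimNonneg : (ℕ → ℚ) → Set
LimNonneg u = ∀ (ε : ℚ) → 0ℚ < ε → ∃ λ N → ∀ i → N ℕ.≤ i → - ε ≤ u i

-- the limit of u is > 0
LimPos : (ℕ → ℚ) → Set
LimPos u = Σ ℚ λ ε → 0ℚ < ε × (∃ λ N → ∀ i → N ℕ.≤ i → ε ≤ u i)

-- For a Cauchy sequence s with real limit T, "⌊ 1 / T ⌋ = m" means
-- T ≠ 0 and m ≤ 1/T < m + 1, equivalently (multiplying by T² > 0)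
-- T - m T² ≥ 0 and (m + 1) T² - T > 0 (the latter also forces T ≠ 0).
FloorInvLimit : (ℕ → ℚ) → ℤ → Set
FloorInvLimit s m =
  Cauchy s
  × LimNonneg (λ N → s N - ι m * (s N * s N))
  × LimPos (λ N → ι (m ℤ.+ + 1) * (s N * s N) - s N)

{-# OPTIONS --safe #-}
module Submission where

-- Write b j = B (2 j), u j = 1 / b j and X j = 1 / (b j + b (j - 1)). The even-index balancing numbers
-- satisfy b (j + 2) = 34 b (j + 1) - b j and the Cassini identity b (j + 1)² - b j b (j + 2) = 36, so
-- u j = X j + X (j + 1) - D j with D j = 36 u j X j X (j + 1), positive and decreasing. The alternating tail
-- S = Σ_{k ≥ n} (-1)^(k - n) u k therefore telescopes to X n minus an alternating sum of the D k, which lies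
-- between D n - D (n + 1) > 0 and D n ≤ X n / (2 (q + 1)), where q = b n + b (n - 1) = 1 / X n. Hence
-- 1 / (q + 1) < S < 1 / q, and the tail in the theorem is (-1)^n S.

open import Defs
open import Data.Nat as ℕ using (ℕ; zero; suc; pred; _∸_; z≤n; s≤s)
import Data.Nat.Properties as ℕP
open import Data.Nat.Coprimality using (1-coprimeTo)
import Data.Nat.Coprimality as Coprimality
open import Data.Nat.Divisibility using (_∣_; divides; ∣-refl; ∣m∣n⇒∣m+n)
open import Data.Integer as ℤ using (ℤ; +_; +[1+_]; -[1+_])
import Data.Integer.Properties as ℤP
open import Data.Rational as ℚ using (ℚ; mkℚ; _/_; _+_; _*_; _-_; -_; _≤_; _<_; 0ℚ; 1ℚ; ½)
import Data.Rational.Properties as ℚP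
open import Data.Product using (∃; _×_; _,_; proj₁; proj₂)
open import Data.Sum using (_⊎_; inj₁; inj₂)
open import Data.Empty using (⊥-elim)
open import Level using (0ℓ)
open import Relation.Nullary using (¬_)
open import Relation.Nullary.Decidable using (dec⇒maybe)
open import Relation.Binary.Definitions using (tri<; tri≈; tri>)
open import Relation.Binary.PropositionalEquality
open import Tactic.RingSolver using (solve-∀)
open import Tactic.RingSolver.Core.AlmostCommutativeRing using (AlmostCommutativeRing; fromCommutativeRing)
import Data.Nat.Tactic.RingSolver as ℕ-Solver
import Data.Integer.Tactic.RingSolver as ℤ-Solver

ℚ-ring : AlmostCommutativeRing 0ℓ 0ℓ
ℚ-ring = fromCommutativeRing ℚP.+-*-commutativeRing (λ p → dec⇒maybe (0ℚ ℚP.≟ p))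

nonNeg*nonNeg⇒nonNeg : ∀ {p q} → 0ℚ ≤ p → 0ℚ ≤ q → 0ℚ ≤ p * q
nonNeg*nonNeg⇒nonNeg {p} {q} 0≤p 0≤q =
  ℚP.nonNegative⁻¹ _ {{ℚP.nonNeg*nonNeg⇒nonNeg p {{ℚ.nonNegative 0≤p}} q {{ℚ.nonNegative 0≤q}}}}

pos*pos⇒pos : ∀ {p q} → 0ℚ < p → 0ℚ < q → 0ℚ < p * q
pos*pos⇒pos {p} {q} 0<p 0<q =
  ℚP.positive⁻¹ _ {{ℚP.pos*pos⇒pos p {{ℚ.positive 0<p}} q {{ℚ.positive 0<q}}}}

*-monoˡ-≤-nonNeg : ∀ {r p q} → 0ℚ ≤ r → p ≤ q → r * p ≤ r * q
*-monoˡ-≤-nonNeg {r} 0≤r = ℚP.*-monoˡ-≤-nonNeg r {{ℚ.nonNegative 0≤r}}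

*-monoʳ-≤-nonNeg : ∀ {r p q} → 0ℚ ≤ r → p ≤ q → p * r ≤ q * r
*-monoʳ-≤-nonNeg {r} 0≤r = ℚP.*-monoʳ-≤-nonNeg r {{ℚ.nonNegative 0≤r}}

*-monoʳ-<-pos : ∀ {r p q} → 0ℚ < r → p < q → r * p < r * q
*-monoʳ-<-pos {r} 0<r = ℚP.*-monoʳ-<-pos r {{ℚ.positive 0<r}}

*-mono-<-≤ : ∀ {p q r s} → 0ℚ ≤ p → p < q → r ≤ s → 0ℚ < s → p * r < q * s
*-mono-<-≤ {p} {q} {r} {s} 0≤p p<q r≤s 0<s =
  ℚP.≤-<-trans (*-monoˡ-≤-nonNeg 0≤p r≤s) (ℚP.*-monoˡ-<-pos s {{ℚ.positive 0<s}} p<q)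

p≤q⇒0≤q-p : ∀ {p q} → p ≤ q → 0ℚ ≤ q - p
p≤q⇒0≤q-p {p} {q} p≤q = subst (_≤ q - p) (ℚP.+-inverseʳ p) (ℚP.+-monoˡ-≤ (- p) p≤q)

p<q⇒0<q-p : ∀ {p q} → p < q → 0ℚ < q - p
p<q⇒0<q-p {p} {q} p<q = subst (_< q - p) (ℚP.+-inverseʳ p) (ℚP.+-monoˡ-< (- p) p<q)

p-q≤p : ∀ {p q} → 0ℚ ≤ q → p - q ≤ p
p-q≤p {p} {q} 0≤q = subst (p - q ≤_) (ℚP.+-identityʳ p) (ℚP.+-monoʳ-≤ p (ℚP.neg-antimono-≤ 0≤q))

-p≤p : ∀ {p} → 0ℚ ≤ p → - p ≤ p
-p≤p 0≤p = ℚP.≤-trans (ℚP.neg-antimono-≤ 0≤p) 0≤p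

p≤[q+1]*p : ∀ {p q} → 0ℚ ≤ q → 0ℚ ≤ p → p ≤ (q + 1ℚ) * p
p≤[q+1]*p {p} {q} 0≤q 0≤p = subst₂ _≤_ (ℚP.+-identityˡ p) (distrib q p) (ℚP.+-monoˡ-≤ p (nonNeg*nonNeg⇒nonNeg 0≤q 0≤p))
  where
  distrib : ∀ q p → q * p + p ≡ (q + 1ℚ) * p
  distrib = solve-∀ ℚ-ring

neg-involutive : ∀ p → - - p ≡ p
neg-involutive = solve-∀ ℚ-ring

-1*p≡-p : ∀ p → (- 1ℚ) * p ≡ - p
-1*p≡-p = solve-∀ ℚ-ring

∣p-q∣≡∣q-p∣ : ∀ p q → ℚ.∣ p - q ∣ ≡ ℚ.∣ q - p ∣
∣p-q∣≡∣q-p∣ p q = trans (sym (ℚP.∣-p∣≡∣p∣ (p - q))) (cong ℚ.∣_∣ (negate p q))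
  where
  negate : ∀ p q → - (p - q) ≡ q - p
  negate = solve-∀ ℚ-ring

¼ ⅛ : ℚ
¼ = + 1 / 4
⅛ = + 1 / 8

∣sgn∣≡1 : ∀ k → ℚ.∣ sgn k ∣ ≡ 1ℚ
∣sgn∣≡1 zero = refl
∣sgn∣≡1 (suc k) = trans (ℚP.∣-p∣≡∣p∣ (sgn k)) (∣sgn∣≡1 k)

∣sgn*p∣≡∣p∣ : ∀ k p → ℚ.∣ sgn k * p ∣ ≡ ℚ.∣ p ∣
∣sgn*p∣≡∣p∣ k p = trans (ℚP.∣p*q∣≡∣p∣*∣q∣ (sgn k) p) (trans (cong (_* ℚ.∣ p ∣) (∣sgn∣≡1 k)) (ℚP.*-identityˡ ℚ.∣ p ∣))

sgn-±1 : ∀ k → sgn k ≡ 1ℚ ⊎ sgn k ≡ - 1ℚ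
sgn-±1 zero = inj₁ refl
sgn-±1 (suc k) with sgn-±1 k
... | inj₁ σ≡1 = inj₂ (cong -_ σ≡1)
... | inj₂ σ≡-1 = inj₁ (cong -_ σ≡-1)

sgn-*-bounds : ∀ k {t} → 0ℚ ≤ t → - t ≤ sgn k * t × sgn k * t ≤ t
sgn-*-bounds k {t} 0≤t with sgn-±1 k
... | inj₁ σ≡1 rewrite σ≡1 | ℚP.*-identityˡ t = -p≤p 0≤t , ℚP.≤-refl
... | inj₂ σ≡-1 rewrite σ≡-1 | -1*p≡-p t = ℚP.≤-refl , -p≤p 0≤t

parity : ∀ n → 2 ∣ n ⊎ 2 ∣ suc n
parity zero = inj₁ (divides 0 refl)
parity (suc n) with parity n
... | inj₁ 2∣n = inj₂ (∣m∣n⇒∣m+n ∣-refl 2∣n)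
... | inj₂ 2∣n+1 = inj₁ 2∣n+1

sgn-even : ∀ {n} → 2 ∣ n → sgn n ≡ 1ℚ
sgn-even (divides k refl) = sgn-2k k
  where
  sgn-2k : ∀ k → sgn (k ℕ.* 2) ≡ 1ℚ
  sgn-2k zero = refl
  sgn-2k (suc k) = trans (neg-involutive (sgn (k ℕ.* 2))) (sgn-2k k)

sgn-odd : ∀ {n} → ¬ 2 ∣ n → sgn n ≡ - 1ℚ
sgn-odd {n} 2∤n with parity n
... | inj₁ 2∣n = ⊥-elim (2∤n 2∣n)
... | inj₂ 2∣n+1 = trans (sym (neg-involutive (sgn n))) (cong -_ (sgn-even 2∣n+1))

-- On the normal form mkℚ z 0 the operations of ℚ compute, so ι is a homomorphism almost by definition.
ι≡mkℚ : ∀ z → ι z ≡ mkℚ z 0 (Coprimality.sym (1-coprimeTo ℤ.∣ z ∣))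
ι≡mkℚ z = ℚP.↥p/↧p≡p (mkℚ z 0 _)

ι-+ : ∀ i j → ι (i ℤ.+ j) ≡ ι i + ι j
ι-+ i j = trans (cong ι (sym (cong₂ ℤ._+_ (ℤP.*-identityʳ i) (ℤP.*-identityʳ j))))
                (sym (cong₂ _+_ (ι≡mkℚ i) (ι≡mkℚ j)))

ι-* : ∀ i j → ι (i ℤ.* j) ≡ ι i * ι j
ι-* i j = sym (cong₂ _*_ (ι≡mkℚ i) (ι≡mkℚ j))

-- Negation on ℚ computes only once the sign of the numerator is known.
ι-neg : ∀ z → ι (ℤ.- z) ≡ - ι z
ι-neg z@(+ zero)   = trans (ι≡mkℚ (ℤ.- z)) (sym (cong -_ (ι≡mkℚ z)))
ι-neg z@(+[1+ _ ]) = trans (ι≡mkℚ (ℤ.- z)) (sym (cong -_ (ι≡mkℚ z)))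
ι-neg z@(-[1+ _ ]) = trans (ι≡mkℚ (ℤ.- z)) (sym (cong -_ (ι≡mkℚ z)))

ι-mono-≤ : ∀ {i j} → i ℤ.≤ j → ι i ≤ ι j
ι-mono-≤ {i} {j} i≤j = subst₂ _≤_ (sym (ι≡mkℚ i)) (sym (ι≡mkℚ j))
  (ℚ.*≤* (subst₂ ℤ._≤_ (sym (ℤP.*-identityʳ i)) (sym (ℤP.*-identityʳ j)) i≤j))

ιℕ : ℕ → ℚ
ιℕ n = ι (+ n)

ιℕ-+ : ∀ m n → ιℕ (m ℕ.+ n) ≡ ιℕ m + ιℕ n
ιℕ-+ m n = trans (cong ι (ℤP.pos-+ m n)) (ι-+ (+ m) (+ n))

ιℕ-* : ∀ m n → ιℕ (m ℕ.* n) ≡ ιℕ m * ιℕ n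
ιℕ-* m n = trans (cong ι (ℤP.pos-* m n)) (ι-* (+ m) (+ n))

ιℕ-mono-≤ : ∀ {m n} → m ℕ.≤ n → ιℕ m ≤ ιℕ n
ιℕ-mono-≤ m≤n = ι-mono-≤ (ℤ.+≤+ m≤n)

ιℕ-nonNeg : ∀ n → 0ℚ ≤ ιℕ n
ιℕ-nonNeg n = ιℕ-mono-≤ {0} {n} z≤n

recip≡mkℚ : ∀ d → recip (suc d) ≡ mkℚ (+ 1) d (1-coprimeTo (suc d))
recip≡mkℚ d = ℚP.↥p/↧p≡p (mkℚ (+ 1) d _)

recip-inverse : ∀ {m} → 0 ℕ.< m → recip m * ιℕ m ≡ 1ℚ
recip-inverse {suc d} _ = trans (cong₂ _*_ (recip≡mkℚ d) (ι≡mkℚ (+ suc d)))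
                                (ℚP.*-inverseˡ (mkℚ (+ suc d) 0 (Coprimality.sym (1-coprimeTo (suc d)))))

recip-pos : ∀ {m} → 0 ℕ.< m → 0ℚ < recip m
recip-pos {suc d} _ = subst (0ℚ <_) (sym (recip≡mkℚ d)) (ℚ.*<* (ℤ.+<+ (s≤s z≤n)))

recip-nonNeg : ∀ m → 0ℚ ≤ recip m
recip-nonNeg zero = ℚP.≤-refl
recip-nonNeg (suc d) = ℚP.<⇒≤ (recip-pos {suc d} (s≤s z≤n))

recip-antimono-≤ : ∀ {m n} → 0 ℕ.< m → m ℕ.≤ n → recip n ≤ recip m
recip-antimono-≤ {suc d} {suc e} _ m≤n = subst₂ _≤_ (sym (recip≡mkℚ e)) (sym (recip≡mkℚ d))
  (ℚ.*≤* (subst₂ ℤ._≤_ (sym (ℤP.*-identityˡ _)) (sym (ℤP.*-identityˡ _)) (ℤ.+≤+ m≤n)))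

recip-antimono-< : ∀ {m n} → 0 ℕ.< m → m ℕ.< n → recip n < recip m
recip-antimono-< {suc d} {suc e} _ m<n = subst₂ _<_ (sym (recip≡mkℚ e)) (sym (recip≡mkℚ d))
  (ℚ.*<* (subst₂ ℤ._<_ (sym (ℤP.*-identityˡ _)) (sym (ℤP.*-identityˡ _)) (ℤ.+<+ m<n)))

reciprocal-defect : ∀ u x y Q P R → u * Q ≡ 1ℚ → x * (Q + P) ≡ 1ℚ → y * (R + Q) ≡ 1ℚ →
                    Q * Q ≡ P * R + ιℕ 36 → x + y - u ≡ ιℕ 36 * (u * x * y)
reciprocal-defect u x y Q P R uQ≡1 xQP≡1 yRQ≡1 cassini = begin
  x + y - u                                          ≡⟨ pad x y u ⟩
  F 1ℚ 1ℚ 1ℚ                                         ≡⟨ cong₂ (λ α β → F α β 1ℚ) uQ≡1 yRQ≡1 ⟨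
  F (u * Q) (y * (R + Q)) 1ℚ                         ≡⟨ cong (F (u * Q) (y * (R + Q))) xQP≡1 ⟨
  F (u * Q) (y * (R + Q)) (x * (Q + P))              ≡⟨ expand u x y Q P R ⟩
  u * x * y * (Q * Q - P * R)                        ≡⟨ cong (λ w → u * x * y * (w - P * R)) cassini ⟩
  u * x * y * (P * R + ιℕ 36 - P * R)                ≡⟨ cancel (u * x * y) (P * R) (ιℕ 36) ⟩
  ιℕ 36 * (u * x * y)                                ∎
  where
  open ≡-Reasoning
  F : ℚ → ℚ → ℚ → ℚ
  F α β γ = x * α * β + y * α * γ - u * γ * β
  pad : ∀ x y u → x + y - u ≡ x * 1ℚ * 1ℚ + y * 1ℚ * 1ℚ - u * 1ℚ * 1ℚ
  pad = solve-∀ ℚ-ring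
  expand : ∀ u x y Q P R → x * (u * Q) * (y * (R + Q)) + y * (u * Q) * (x * (Q + P)) - u * (x * (Q + P)) * (y * (R + Q))
                           ≡ u * x * y * (Q * Q - P * R)
  expand = solve-∀ ℚ-ring
  cancel : ∀ w a c → w * (a + c - a) ≡ c * w
  cancel = solve-∀ ℚ-ring

Eventually : (ℕ → Set) → Set
Eventually P = ∃ λ N → ∀ i → N ℕ.≤ i → P i

Eventually-≥ : ∀ k → Eventually (k ℕ.≤_)
Eventually-≥ k = k , λ _ k≤i → k≤i

Eventually-× : ∀ {P Q} → Eventually P → Eventually Q → Eventually (λ i → P i × Q i)
Eventually-× (M , p) (N , q) =
  M ℕ.⊔ N , λ i M⊔N≤i → p i (ℕP.≤-trans (ℕP.m≤m⊔n M N) M⊔N≤i) , q i (ℕP.≤-trans (ℕP.m≤n⊔m M N) M⊔N≤i)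

Eventually-map : ∀ {P Q : ℕ → Set} → (∀ i → P i → Q i) → Eventually P → Eventually Q
Eventually-map f (N , p) = N , λ i N≤i → f i (p i N≤i)

Eventually-reindex : ∀ {P} (f : ℕ → ℕ) → (∀ i → i ℕ.≤ f i) → Eventually P → Eventually (λ i → P (f i))
Eventually-reindex f i≤fi (N , p) = N , λ i N≤i → p (f i) (ℕP.≤-trans N≤i (i≤fi i))

recip-eventually-≤ : ∀ ε → 0ℚ < ε → Eventually (λ m → recip m ≤ ε)
recip-eventually-≤ ε@(mkℚ +[1+ p ] q _) _ = suc q , bound
  where
  bound : ∀ m → suc q ℕ.≤ m → recip m ≤ ε
  bound (suc e) (s≤s q≤e) = subst (_≤ ε) (sym (recip≡mkℚ e)) (ℚ.*≤* (ℤ.+≤+ (begin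
    suc q ℕ.+ 0         ≡⟨ ℕP.+-identityʳ (suc q) ⟩
    suc q               ≤⟨ s≤s q≤e ⟩
    suc e               ≤⟨ ℕP.m≤m+n (suc e) (p ℕ.* suc e) ⟩
    suc p ℕ.* suc e     ∎)))
    where open ℕP.≤-Reasoning
recip-eventually-≤ (mkℚ (+ zero) _ _) (ℚ.*<* (ℤ.+<+ ()))
recip-eventually-≤ (mkℚ -[1+ _ ] _ _) (ℚ.*<* ())

Cauchy-intro : ∀ {s} → (∀ ε → 0ℚ < ε → ∃ λ K → ∀ i d → K ℕ.≤ i → ℚ.∣ s (suc i ℕ.+ d) - s i ∣ ≤ ε) →
               Cauchy s
Cauchy-intro {s} modulus ε 0<ε with modulus ε 0<ε
... | K , close = K , bound
  where
  bound : ∀ i j → K ℕ.≤ i → K ℕ.≤ j → ℚ.∣ s i - s j ∣ ≤ ε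
  bound i j K≤i K≤j with ℕP.<-cmp i j
  ... | tri≈ _ refl _ = subst (_≤ ε) (cong ℚ.∣_∣ (sym (ℚP.+-inverseʳ (s i)))) (ℚP.<⇒≤ 0<ε)
  ... | tri< i<j _ _ with ℕP.m≤n⇒∃[o]m+o≡n i<j
  ...   | d , refl = subst (_≤ ε) (∣p-q∣≡∣q-p∣ (s j) (s i)) (close i d K≤i)
  bound i j K≤i K≤j | tri> _ _ j<i with ℕP.m≤n⇒∃[o]m+o≡n j<i
  ...   | d , refl = close j d K≤j

Cauchy-resp : ∀ {s t} → (∀ i j → ℚ.∣ t i - t j ∣ ≡ ℚ.∣ s i - s j ∣) → Cauchy s → Cauchy t
Cauchy-resp eq cauchy ε 0<ε with cauchy ε 0<ε
... | K , close = K , λ i j K≤i K≤j → subst (_≤ ε) (sym (eq i j)) (close i j K≤i K≤j)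

LimPos-cong : ∀ {u v} → (∀ i → u i ≡ v i) → LimPos u → LimPos v
LimPos-cong eq (ε , 0<ε , bound) = ε , 0<ε , Eventually-map (λ i → subst (ε ≤_) (eq i)) bound

LimPos⇒LimNonneg : ∀ {u} → LimPos u → LimNonneg u
LimPos⇒LimNonneg (ε , 0<ε , bound) η 0<η =
  Eventually-map (λ _ ε≤u → ℚP.≤-trans (ℚP.neg-antimono-≤ (ℚP.<⇒≤ 0<η)) (ℚP.≤-trans (ℚP.<⇒≤ 0<ε) ε≤u)) bound

LimPos-* : ∀ {u v} → LimPos u → LimPos v → LimPos (λ i → u i * v i)
LimPos-* {u} {v} (ε , 0<ε , u-bound) (η , 0<η , v-bound) =
  ε * η , pos*pos⇒pos 0<ε 0<η , Eventually-map product (Eventually-× u-bound v-bound)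
  where
  product : ∀ i → ε ≤ u i × η ≤ v i → ε * η ≤ u i * v i
  product _ (ε≤u , η≤v) = ℚP.≤-trans (*-monoʳ-≤-nonNeg (ℚP.<⇒≤ 0<η) ε≤u)
                                   (*-monoˡ-≤-nonNeg (ℚP.≤-trans (ℚP.<⇒≤ 0<ε) ε≤u) η≤v)

-- The limit T of S satisfies 1 / (q + 1) < T < 1 / q, with room to spare.
Bracketed : ℚ → (ℕ → ℚ) → Set
Bracketed q S = LimPos (λ N → S N * (1ℚ - q * S N)) × LimPos (λ N → S N * ((q + 1ℚ) * S N - 1ℚ))

floorInvLimit-intro : ∀ {s m} → Cauchy s → LimPos (λ N → s N * (1ℚ - ι m * s N)) →
                      LimPos (λ N → s N * (ι (m ℤ.+ + 1) * s N - 1ℚ)) → FloorInvLimit s m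
floorInvLimit-intro {s} {m} cauchy below above =
  cauchy ,
  LimPos⇒LimNonneg (LimPos-cong (λ N → factor₁ (s N) (ι m)) below) ,
  LimPos-cong (λ N → factor₂ (s N) (ι (m ℤ.+ + 1))) above
  where
  factor₁ : ∀ x c → x * (1ℚ - c * x) ≡ x - c * (x * x)
  factor₁ = solve-∀ ℚ-ring
  factor₂ : ∀ x c → x * (c * x - 1ℚ) ≡ c * (x * x) - x
  factor₂ = solve-∀ ℚ-ring

floorInvLimit-of-bracketed : ∀ {s S m} → (∀ N → s N ≡ S N) → Cauchy S → Bracketed (ι m) S →
                             FloorInvLimit s m
floorInvLimit-of-bracketed {s} {S} {m} s≡S cauchy (below , above) = floorInvLimit-intro {s} {m}
  (Cauchy-resp {S} {s} (λ i j → cong₂ (λ a b → ℚ.∣ a - b ∣) (s≡S i) (s≡S j)) cauchy)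
  (LimPos-cong (λ N → cong (λ x → x * (1ℚ - ι m * x)) (sym (s≡S N))) below)
  (LimPos-cong (λ N → cong₂ (λ x c → x * (c * x - 1ℚ)) (sym (s≡S N)) (sym (ι-+ m (+ 1)))) above)

-- If 1 / (q + 1) < T < 1 / q then -(q + 1) < 1 / (- T) < - q: the two brackets trade places.
floorInvLimit-of-bracketed-neg : ∀ {s S m} → (∀ N → s N ≡ - S N) → Cauchy S → Bracketed (ι m) S →
                                 FloorInvLimit s (ℤ.- (m ℤ.+ + 1))
floorInvLimit-of-bracketed-neg {s} {S} {m} s≡-S cauchy (below , above) = floorInvLimit-intro {s} {ℤ.- (m ℤ.+ + 1)}
  (Cauchy-resp {S} {s} (λ i j → trans (cong₂ (λ a b → ℚ.∣ a - b ∣) (s≡-S i) (s≡-S j)) (∣-p--q∣ (S i) (S j))) cauchy)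
  (LimPos-cong (λ N → trans (swap₁ (S N) (ι m)) (cong₂ (λ x c → x * (1ℚ - c * x)) (sym (s≡-S N)) (sym ι-m′))) above)
  (LimPos-cong (λ N → trans (swap₂ (S N) (ι m)) (cong₂ (λ x c → x * (c * x - 1ℚ)) (sym (s≡-S N)) (sym ι-m′+1))) below)
  where
  ι-m′ : ι (ℤ.- (m ℤ.+ + 1)) ≡ - (ι m + 1ℚ)
  ι-m′ = trans (ι-neg (m ℤ.+ + 1)) (cong -_ (ι-+ m (+ 1)))
  ι-m′+1 : ι (ℤ.- (m ℤ.+ + 1) ℤ.+ + 1) ≡ - (ι m + 1ℚ) + 1ℚ
  ι-m′+1 = trans (ι-+ (ℤ.- (m ℤ.+ + 1)) (+ 1)) (cong (_+ 1ℚ) ι-m′)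
  ∣-p--q∣ : ∀ p q → ℚ.∣ - p - - q ∣ ≡ ℚ.∣ p - q ∣
  ∣-p--q∣ p q = trans (cong ℚ.∣_∣ (negate p q)) (ℚP.∣-p∣≡∣p∣ (p - q))
    where
    negate : ∀ p q → - p - - q ≡ - (p - q)
    negate = solve-∀ ℚ-ring
  swap₁ : ∀ x c → x * ((c + 1ℚ) * x - 1ℚ) ≡ (- x) * (1ℚ - (- (c + 1ℚ)) * (- x))
  swap₁ = solve-∀ ℚ-ring
  swap₂ : ∀ x c → x * (1ℚ - c * x) ≡ (- x) * ((- (c + 1ℚ) + 1ℚ) * (- x) - 1ℚ)
  swap₂ = solve-∀ ℚ-ring

alt : (ℕ → ℚ) → ℕ → ℕ → ℚ
alt f k zero = f k
alt f k (suc N) = f k - alt f (suc k) N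

AntitoneNonNegFrom : ℕ → (ℕ → ℚ) → Set
AntitoneNonNegFrom k f = ∀ j → k ℕ.≤ j → 0ℚ ≤ f j × f (suc j) ≤ f j

AntitoneNonNegFrom-mono : ∀ {k l f} → k ℕ.≤ l → AntitoneNonNegFrom k f → AntitoneNonNegFrom l f
AntitoneNonNegFrom-mono k≤l mono j l≤j = mono j (ℕP.≤-trans k≤l l≤j)

alt-bounds : ∀ {k f} → AntitoneNonNegFrom k f → ∀ N → 0ℚ ≤ alt f k N × alt f k N ≤ f k
alt-bounds {k} mono zero = proj₁ (mono k ℕP.≤-refl) , ℚP.≤-refl
alt-bounds {k} mono (suc N) with alt-bounds (AntitoneNonNegFrom-mono (ℕP.n≤1+n k) mono) N
... | 0≤A , A≤f[k+1] = p≤q⇒0≤q-p (ℚP.≤-trans A≤f[k+1] (proj₂ (mono k ℕP.≤-refl))) , p-q≤p 0≤A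

alt-lower : ∀ {k f} → AntitoneNonNegFrom k f → ∀ N → f k - f (suc k) ≤ alt f k (suc N)
alt-lower {k} {f} mono N =
  ℚP.+-monoʳ-≤ (f k) (ℚP.neg-antimono-≤ (proj₂ (alt-bounds (AntitoneNonNegFrom-mono (ℕP.n≤1+n k) mono) N)))

alt-split : ∀ f k i d → alt f k (suc i ℕ.+ d) ≡ alt f k i + sgn (suc i) * alt f (suc i ℕ.+ k) d
alt-split f k zero d = regroup (f k) (alt f (suc k) d)
  where
  regroup : ∀ a A → a - A ≡ a + (- 1ℚ) * A
  regroup = solve-∀ ℚ-ring
alt-split f k (suc i) d = begin
  f k - alt f (suc k) (suc i ℕ.+ d)
    ≡⟨ cong (λ A → f k - A) (alt-split f (suc k) i d) ⟩
  f k - (alt f (suc k) i + sgn (suc i) * alt f (suc i ℕ.+ suc k) d)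
    ≡⟨ cong (λ j → f k - (alt f (suc k) i + sgn (suc i) * alt f j d)) (ℕP.+-suc (suc i) k) ⟩
  f k - (alt f (suc k) i + sgn (suc i) * alt f (suc (suc i ℕ.+ k)) d)
    ≡⟨ regroup (f k) (alt f (suc k) i) (sgn (suc i)) (alt f (suc (suc i ℕ.+ k)) d) ⟩
  (f k - alt f (suc k) i) + (- sgn (suc i)) * alt f (suc (suc i ℕ.+ k)) d ∎
  where
  open ≡-Reasoning
  regroup : ∀ a A σ G → a - (A + σ * G) ≡ (a - A) + (- σ) * G
  regroup = solve-∀ ℚ-ring

alt-Cauchy : ∀ {k f} → AntitoneNonNegFrom k f → (∀ ε → 0ℚ < ε → Eventually (λ j → f j ≤ ε)) →
             Cauchy (alt f k)
alt-Cauchy {k} {f} mono small = Cauchy-intro {alt f k} modulus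
  where
  modulus : ∀ ε → 0ℚ < ε → ∃ λ K → ∀ i d → K ℕ.≤ i → ℚ.∣ alt f k (suc i ℕ.+ d) - alt f k i ∣ ≤ ε
  modulus ε 0<ε with small ε 0<ε
  ... | K , f≤ε = K , bound
    where
    bound : ∀ i d → K ℕ.≤ i → ℚ.∣ alt f k (suc i ℕ.+ d) - alt f k i ∣ ≤ ε
    bound i d K≤i = begin
      ℚ.∣ alt f k (suc i ℕ.+ d) - alt f k i ∣             ≡⟨ cong (λ A → ℚ.∣ A - alt f k i ∣) (alt-split f k i d) ⟩
      ℚ.∣ alt f k i + sgn (suc i) * tail - alt f k i ∣    ≡⟨ cong ℚ.∣_∣ (cancel (alt f k i) (sgn (suc i) * tail)) ⟩
      ℚ.∣ sgn (suc i) * tail ∣                            ≡⟨ ∣sgn*p∣≡∣p∣ (suc i) tail ⟩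
      ℚ.∣ tail ∣                                          ≡⟨ ℚP.0≤p⇒∣p∣≡p (proj₁ tail-bounds) ⟩
      tail                                              ≤⟨ proj₂ tail-bounds ⟩
      f (suc i ℕ.+ k)                                   ≤⟨ f≤ε (suc i ℕ.+ k) K≤i+k ⟩
      ε                                                 ∎
      where
      open ℚP.≤-Reasoning
      tail : ℚ
      tail = alt f (suc i ℕ.+ k) d
      k≤i+k : k ℕ.≤ suc i ℕ.+ k
      k≤i+k = ℕP.m≤n+m k (suc i)
      tail-bounds : 0ℚ ≤ tail × tail ≤ f (suc i ℕ.+ k)
      tail-bounds = alt-bounds (AntitoneNonNegFrom-mono k≤i+k mono) d
      K≤i+k : K ℕ.≤ suc i ℕ.+ k
      K≤i+k = ℕP.≤-trans K≤i (ℕP.≤-trans (ℕP.n≤1+n i) (ℕP.m≤m+n (suc i) k))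
      cancel : ∀ a b → a + b - a ≡ b
      cancel = solve-∀ ℚ-ring

alt-telescope : ∀ (g v : ℕ → ℚ) k N →
                alt v k N ≡ g k + sgn N * g (suc N ℕ.+ k) - alt (λ j → g j + g (suc j) - v j) k N
alt-telescope g v k zero = base (g k) (g (suc k)) (v k)
  where
  base : ∀ a b c → c ≡ a + 1ℚ * b - (a + b - c)
  base = solve-∀ ℚ-ring
alt-telescope g v k (suc N) = begin
  v k - alt v (suc k) N
    ≡⟨ cong (λ A → v k - A) (alt-telescope g v (suc k) N) ⟩
  v k - (g (suc k) + sgn N * g (suc N ℕ.+ suc k) - alt d (suc k) N)
    ≡⟨ cong (λ j → v k - (g (suc k) + sgn N * g j - alt d (suc k) N)) (ℕP.+-suc (suc N) k) ⟩
  v k - (g (suc k) + sgn N * g (suc (suc N ℕ.+ k)) - alt d (suc k) N)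
    ≡⟨ regroup (v k) (g k) (g (suc k)) (sgn N) (g (suc (suc N ℕ.+ k))) (alt d (suc k) N) ⟩
  g k + (- sgn N) * g (suc (suc N ℕ.+ k)) - (d k - alt d (suc k) N) ∎
  where
  open ≡-Reasoning
  d : ℕ → ℚ
  d j = g j + g (suc j) - v j
  regroup : ∀ c a b σ G A → c - (b + σ * G - A) ≡ a + (- σ) * G - ((a + b - c) - A)
  regroup = solve-∀ ℚ-ring

Recurrence : ℤ → (ℕ → ℤ) → Set
Recurrence c a = ∀ n → a (2 ℕ.+ n) ≡ c ℤ.* a (1 ℕ.+ n) ℤ.- a n

recurrence-step2 : ∀ {c a} → Recurrence c a →
                   ∀ n → a (4 ℕ.+ n) ≡ (c ℤ.* c ℤ.- + 2) ℤ.* a (2 ℕ.+ n) ℤ.- a n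
recurrence-step2 {c} {a} rec n = begin
  a (4 ℕ.+ n)
    ≡⟨ rec (2 ℕ.+ n) ⟩
  c ℤ.* a (3 ℕ.+ n) ℤ.- a₂
    ≡⟨ cong (λ y → c ℤ.* y ℤ.- a₂) (rec (1 ℕ.+ n)) ⟩
  c ℤ.* (c ℤ.* a₂ ℤ.- a₁) ℤ.- a₂
    ≡⟨ regroup c a₂ a₁ ⟩
  (c ℤ.* c ℤ.- + 2) ℤ.* a₂ ℤ.+ (a₂ ℤ.- c ℤ.* a₁)
    ≡⟨ cong (λ y → (c ℤ.* c ℤ.- + 2) ℤ.* a₂ ℤ.+ (y ℤ.- c ℤ.* a₁)) (rec n) ⟩
  (c ℤ.* c ℤ.- + 2) ℤ.* a₂ ℤ.+ ((c ℤ.* a₁ ℤ.- a n) ℤ.- c ℤ.* a₁)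
    ≡⟨ cancel (c ℤ.* c ℤ.- + 2) a₂ (c ℤ.* a₁) (a n) ⟩
  (c ℤ.* c ℤ.- + 2) ℤ.* a₂ ℤ.- a n ∎
  where
  open ≡-Reasoning
  a₁ a₂ : ℤ
  a₁ = a (1 ℕ.+ n)
  a₂ = a (2 ℕ.+ n)
  regroup : ∀ c x y → c ℤ.* (c ℤ.* x ℤ.- y) ℤ.- x ≡ (c ℤ.* c ℤ.- + 2) ℤ.* x ℤ.+ (x ℤ.- c ℤ.* y)
  regroup = ℤ-Solver.solve-∀
  cancel : ∀ k x y z → k ℤ.* x ℤ.+ ((y ℤ.- z) ℤ.- y) ≡ k ℤ.* x ℤ.- z
  cancel = ℤ-Solver.solve-∀

recurrence-even : ∀ {c a} → Recurrence c a → Recurrence (c ℤ.* c ℤ.- + 2) (λ j → a (2 ℕ.* j))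
recurrence-even {c} {a} rec j = begin
  a (2 ℕ.* (2 ℕ.+ j))                                  ≡⟨ cong a (ℕP.*-distribˡ-+ 2 2 j) ⟩
  a (4 ℕ.+ 2 ℕ.* j)                                    ≡⟨ recurrence-step2 {c} {a} rec (2 ℕ.* j) ⟩
  (c ℤ.* c ℤ.- + 2) ℤ.* a (2 ℕ.+ 2 ℕ.* j) ℤ.- a (2 ℕ.* j)
    ≡⟨ cong (λ i → (c ℤ.* c ℤ.- + 2) ℤ.* a i ℤ.- a (2 ℕ.* j)) (sym (ℕP.*-distribˡ-+ 2 1 j)) ⟩
  (c ℤ.* c ℤ.- + 2) ℤ.* a (2 ℕ.* (1 ℕ.+ j)) ℤ.- a (2 ℕ.* j) ∎
  where open ≡-Reasoning

cassini : ∀ {c a} → Recurrence c a →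
          ∀ n → a (1 ℕ.+ n) ℤ.* a (1 ℕ.+ n) ℤ.- a n ℤ.* a (2 ℕ.+ n) ≡ a 1 ℤ.* a 1 ℤ.- a 0 ℤ.* a 2
cassini rec zero = refl
cassini {c} {a} rec (suc n) = trans invariant (cassini {c} {a} rec n)
  where
  open ≡-Reasoning
  a₀ a₁ a₂ : ℤ
  a₀ = a n
  a₁ = a (1 ℕ.+ n)
  a₂ = a (2 ℕ.+ n)
  invariant : a₂ ℤ.* a₂ ℤ.- a₁ ℤ.* a (3 ℕ.+ n) ≡ a₁ ℤ.* a₁ ℤ.- a₀ ℤ.* a₂
  invariant = begin
    a₂ ℤ.* a₂ ℤ.- a₁ ℤ.* a (3 ℕ.+ n)                     ≡⟨ cong (λ y → a₂ ℤ.* a₂ ℤ.- a₁ ℤ.* y) (rec (1 ℕ.+ n)) ⟩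
    a₂ ℤ.* a₂ ℤ.- a₁ ℤ.* (c ℤ.* a₂ ℤ.- a₁)               ≡⟨ regroup c a₁ a₂ ⟩
    a₁ ℤ.* a₁ ℤ.- (c ℤ.* a₁ ℤ.- a₂) ℤ.* a₂               ≡⟨ cong (λ y → a₁ ℤ.* a₁ ℤ.- (c ℤ.* a₁ ℤ.- y) ℤ.* a₂) (rec n) ⟩
    a₁ ℤ.* a₁ ℤ.- (c ℤ.* a₁ ℤ.- (c ℤ.* a₁ ℤ.- a₀)) ℤ.* a₂ ≡⟨ cancel (c ℤ.* a₁) a₁ a₀ a₂ ⟩
    a₁ ℤ.* a₁ ℤ.- a₀ ℤ.* a₂                              ∎
    where
    regroup : ∀ c x y → y ℤ.* y ℤ.- x ℤ.* (c ℤ.* y ℤ.- x) ≡ x ℤ.* x ℤ.- (c ℤ.* x ℤ.- y) ℤ.* y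
    regroup = ℤ-Solver.solve-∀
    cancel : ∀ w x z y → x ℤ.* x ℤ.- (w ℤ.- (w ℤ.- z)) ℤ.* y ≡ x ℤ.* x ℤ.- z ℤ.* y
    cancel = ℤ-Solver.solve-∀

recurrence-unique : ∀ {c a a′} → Recurrence c a → Recurrence c a′ → a 0 ≡ a′ 0 → a 1 ≡ a′ 1 →
                    ∀ n → a n ≡ a′ n
recurrence-unique {c} {a} {a′} rec rec′ eq₀ eq₁ n = proj₁ (consecutive n)
  where
  consecutive : ∀ n → a n ≡ a′ n × a (suc n) ≡ a′ (suc n)
  consecutive zero = eq₀ , eq₁
  consecutive (suc n) with consecutive n
  ... | eqₙ , eqₙ₊₁ = eqₙ₊₁ , trans (rec n) (trans (cong₂ (λ x y → c ℤ.* x ℤ.- y) eqₙ₊₁ eqₙ) (sym (rec′ n)))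

mutual
  Bℕ : ℕ → ℕ
  Bℕ zero = 0
  Bℕ (suc n) = Bℕ n ℕ.+ ΔBℕ n

  -- ΔBℕ n = B (n + 1) - B n, and the recurrence gives ΔB (n + 1) = 4 B (n + 1) + ΔB n: in ℕ, B is visibly
  -- nonnegative and increasing.
  ΔBℕ : ℕ → ℕ
  ΔBℕ zero = 1
  ΔBℕ (suc n) = 4 ℕ.* Bℕ (suc n) ℕ.+ ΔBℕ n

Bℕ-recurrence : ∀ n → Bℕ (2 ℕ.+ n) ℕ.+ Bℕ n ≡ 6 ℕ.* Bℕ (1 ℕ.+ n)
Bℕ-recurrence n = unfolded (Bℕ n) (ΔBℕ n)
  where
  unfolded : ∀ c g → (c ℕ.+ g) ℕ.+ (4 ℕ.* (c ℕ.+ g) ℕ.+ g) ℕ.+ c ≡ 6 ℕ.* (c ℕ.+ g)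
  unfolded = ℕ-Solver.solve-∀

B≡Bℕ : ∀ n → B n ≡ + Bℕ n
B≡Bℕ = recurrence-unique {+ 6} {B} (λ _ → refl) +Bℕ-recurrence refl refl
  where
  +Bℕ-recurrence : Recurrence (+ 6) (λ n → + Bℕ n)
  +Bℕ-recurrence n = begin
    + Bℕ (2 ℕ.+ n)                              ≡⟨ add-sub (+ Bℕ (2 ℕ.+ n)) (+ Bℕ n) ⟩
    (+ Bℕ (2 ℕ.+ n) ℤ.+ + Bℕ n) ℤ.- + Bℕ n       ≡⟨ cong (ℤ._- + Bℕ n) (sym (ℤP.pos-+ (Bℕ (2 ℕ.+ n)) (Bℕ n))) ⟩
    + (Bℕ (2 ℕ.+ n) ℕ.+ Bℕ n) ℤ.- + Bℕ n         ≡⟨ cong (λ m → + m ℤ.- + Bℕ n) (Bℕ-recurrence n) ⟩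
    + (6 ℕ.* Bℕ (1 ℕ.+ n)) ℤ.- + Bℕ n            ≡⟨ cong (ℤ._- + Bℕ n) (ℤP.pos-* 6 (Bℕ (1 ℕ.+ n))) ⟩
    + 6 ℤ.* + Bℕ (1 ℕ.+ n) ℤ.- + Bℕ n            ∎
    where
    open ≡-Reasoning
    add-sub : ∀ x y → x ≡ (x ℤ.+ y) ℤ.- y
    add-sub = ℤ-Solver.solve-∀

ΔBℕ-pos : ∀ n → 0 ℕ.< ΔBℕ n
ΔBℕ-pos zero = s≤s z≤n
ΔBℕ-pos (suc n) = ℕP.≤-trans (ΔBℕ-pos n) (ℕP.m≤n+m (ΔBℕ n) _)

evenB : ℕ → ℤ
evenB j = B (2 ℕ.* j)

evenB-recurrence : Recurrence (+ 34) evenB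
evenB-recurrence = recurrence-even {+ 6} {B} (λ _ → refl)

evenB-cassini : ∀ j → evenB (1 ℕ.+ j) ℤ.* evenB (1 ℕ.+ j) ℤ.- evenB j ℤ.* evenB (2 ℕ.+ j) ≡ + 36
evenB-cassini = cassini {+ 34} {evenB} evenB-recurrence

b : ℕ → ℕ
b j = ℤ.∣ evenB j ∣

b≡Bℕ : ∀ j → b j ≡ Bℕ (2 ℕ.* j)
b≡Bℕ j = cong ℤ.∣_∣ (B≡Bℕ (2 ℕ.* j))

+b≡evenB : ∀ j → + b j ≡ evenB j
+b≡evenB j = trans (cong +_ (b≡Bℕ j)) (sym (B≡Bℕ (2 ℕ.* j)))

b-recurrence : ∀ j → b (2 ℕ.+ j) ℕ.+ b j ≡ 34 ℕ.* b (1 ℕ.+ j)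
b-recurrence j = ℤP.+-injective (begin
  + (b (2 ℕ.+ j) ℕ.+ b j)                    ≡⟨ ℤP.pos-+ (b (2 ℕ.+ j)) (b j) ⟩
  + b (2 ℕ.+ j) ℤ.+ + b j                    ≡⟨ cong₂ ℤ._+_ (+b≡evenB (2 ℕ.+ j)) (+b≡evenB j) ⟩
  B₂ ℤ.+ B₀                                  ≡⟨ cong (ℤ._+ B₀) (evenB-recurrence j) ⟩
  + 34 ℤ.* B₁ ℤ.- B₀ ℤ.+ B₀                  ≡⟨ sub-add (+ 34 ℤ.* B₁) B₀ ⟩
  + 34 ℤ.* B₁                                ≡⟨ cong (+ 34 ℤ.*_) (sym (+b≡evenB (1 ℕ.+ j))) ⟩
  + 34 ℤ.* + b (1 ℕ.+ j)                     ≡⟨ ℤP.pos-* 34 (b (1 ℕ.+ j)) ⟨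
  + (34 ℕ.* b (1 ℕ.+ j))                     ∎)
  where
  open ≡-Reasoning
  B₀ B₁ B₂ : ℤ
  B₀ = evenB j
  B₁ = evenB (1 ℕ.+ j)
  B₂ = evenB (2 ℕ.+ j)
  sub-add : ∀ x y → x ℤ.- y ℤ.+ y ≡ x
  sub-add = ℤ-Solver.solve-∀

b-cassini : ∀ j → b (1 ℕ.+ j) ℕ.* b (1 ℕ.+ j) ≡ b j ℕ.* b (2 ℕ.+ j) ℕ.+ 36
b-cassini j = ℤP.+-injective (begin
  + (b (1 ℕ.+ j) ℕ.* b (1 ℕ.+ j))            ≡⟨ ℤP.pos-* (b (1 ℕ.+ j)) (b (1 ℕ.+ j)) ⟩
  + b (1 ℕ.+ j) ℤ.* + b (1 ℕ.+ j)            ≡⟨ cong₂ ℤ._*_ (+b≡evenB (1 ℕ.+ j)) (+b≡evenB (1 ℕ.+ j)) ⟩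
  B₁ ℤ.* B₁                                  ≡⟨ sub-add (B₁ ℤ.* B₁) (B₀ ℤ.* B₂) ⟩
  B₀ ℤ.* B₂ ℤ.+ (B₁ ℤ.* B₁ ℤ.- B₀ ℤ.* B₂)    ≡⟨ cong (λ y → B₀ ℤ.* B₂ ℤ.+ y) (evenB-cassini j) ⟩
  B₀ ℤ.* B₂ ℤ.+ + 36                         ≡⟨ cong₂ (λ x y → x ℤ.* y ℤ.+ + 36) (+b≡evenB j) (+b≡evenB (2 ℕ.+ j)) ⟨
  + b j ℤ.* + b (2 ℕ.+ j) ℤ.+ + 36           ≡⟨ cong (ℤ._+ + 36) (ℤP.pos-* (b j) (b (2 ℕ.+ j))) ⟨
  + (b j ℕ.* b (2 ℕ.+ j)) ℤ.+ + 36           ≡⟨ ℤP.pos-+ (b j ℕ.* b (2 ℕ.+ j)) 36 ⟨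
  + (b j ℕ.* b (2 ℕ.+ j) ℕ.+ 36)             ∎)
  where
  open ≡-Reasoning
  B₀ B₁ B₂ : ℤ
  B₀ = evenB j
  B₁ = evenB (1 ℕ.+ j)
  B₂ = evenB (2 ℕ.+ j)
  sub-add : ∀ x y → x ≡ y ℤ.+ (x ℤ.- y)
  sub-add = ℤ-Solver.solve-∀

b-< : ∀ j → b j ℕ.< b (suc j)
b-< j = begin-strict
  b j                  ≡⟨ b≡Bℕ j ⟩
  Bℕ (2 ℕ.* j)         <⟨ ℕP.m<m+n _ (ΔBℕ-pos (2 ℕ.* j)) ⟩
  Bℕ (1 ℕ.+ 2 ℕ.* j)   <⟨ ℕP.m<m+n _ (ΔBℕ-pos (1 ℕ.+ 2 ℕ.* j)) ⟩
  Bℕ (2 ℕ.+ 2 ℕ.* j)   ≡⟨ cong Bℕ (ℕP.*-distribˡ-+ 2 1 j) ⟨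
  Bℕ (2 ℕ.* suc j)     ≡⟨ b≡Bℕ (suc j) ⟨
  b (suc j)            ∎
  where open ℕP.≤-Reasoning

6≤b : ∀ j → 6 ℕ.≤ b (suc j)
6≤b zero = ℕP.≤-refl
6≤b (suc j) = ℕP.≤-trans (6≤b j) (ℕP.<⇒≤ (b-< (suc j)))

b-pos : ∀ i → 0 ℕ.< b (suc i)
b-pos i = ℕP.≤-trans (s≤s z≤n) (6≤b i)

j≤b : ∀ j → j ℕ.≤ b j
j≤b zero = z≤n
j≤b (suc j) = ℕP.≤-trans (s≤s (j≤b j)) (b-< j)

pairSum : ℕ → ℕ
pairSum j = b j ℕ.+ b (pred j)

pairSum-pos : ∀ i → 0 ℕ.< pairSum (suc i)
pairSum-pos i = ℕP.≤-trans (b-pos i) (ℕP.m≤m+n (b (suc i)) (b i))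

pairSum-mono : ∀ j → pairSum j ℕ.≤ pairSum (suc j)
pairSum-mono zero = z≤n
pairSum-mono (suc i) = ℕP.+-mono-≤ (ℕP.<⇒≤ (b-< (suc i))) (ℕP.<⇒≤ (b-< i))

j≤pairSum : ∀ j → j ℕ.≤ pairSum j
j≤pairSum j = ℕP.≤-trans (j≤b j) (ℕP.m≤m+n (b j) (b (pred j)))

pairSum-bound : ∀ i → 72 ℕ.* (pairSum (suc i) ℕ.+ 1) ℕ.≤ b (suc i) ℕ.* pairSum (suc (suc i))
pairSum-bound i = begin
  72 ℕ.* (Q ℕ.+ P ℕ.+ 1)    ≡⟨ cong (72 ℕ.*_) (trans (ℕP.+-comm (Q ℕ.+ P) 1) (sym (ℕP.+-suc Q P))) ⟩
  72 ℕ.* (Q ℕ.+ suc P)      ≤⟨ ℕP.*-monoʳ-≤ 72 (ℕP.+-monoʳ-≤ Q (b-< i)) ⟩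
  72 ℕ.* (Q ℕ.+ Q)          ≡⟨ double Q ⟩
  Q ℕ.* 144                 ≤⟨ ℕP.*-monoʳ-≤ Q (ℕP.≤-trans (ℕP.m≤m+n 144 60) (ℕP.*-monoʳ-≤ 34 (6≤b i))) ⟩
  Q ℕ.* (34 ℕ.* Q)          ≡⟨ cong (Q ℕ.*_) (b-recurrence i) ⟨
  Q ℕ.* (R ℕ.+ P)           ≤⟨ ℕP.*-monoʳ-≤ Q (ℕP.+-monoʳ-≤ R (ℕP.<⇒≤ (b-< i))) ⟩
  Q ℕ.* (R ℕ.+ Q)           ∎
  where
  open ℕP.≤-Reasoning
  P Q R : ℕ
  P = b i
  Q = b (suc i)
  R = b (suc (suc i))
  double : ∀ q → 72 ℕ.* (q ℕ.+ q) ≡ q ℕ.* 144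
  double = ℕ-Solver.solve-∀

B-pairSum : ∀ a → B (2 ℕ.* suc a) ℤ.+ B (2 ℕ.* suc a ∸ 2) ≡ + pairSum (suc a)
B-pairSum a = begin
  B (2 ℕ.* suc a) ℤ.+ B (2 ℕ.* suc a ∸ 2)    ≡⟨ cong (λ k → B (2 ℕ.* suc a) ℤ.+ B (k ∸ 2)) (ℕP.*-distribˡ-+ 2 1 a) ⟩
  B (2 ℕ.* suc a) ℤ.+ B (2 ℕ.* a)            ≡⟨ cong₂ ℤ._+_ (+b≡evenB (suc a)) (+b≡evenB a) ⟨
  + b (suc a) ℤ.+ + b a                      ≡⟨ ℤP.pos-+ (b (suc a)) (b a) ⟨
  + pairSum (suc a)                          ∎
  where open ≡-Reasoning

u : ℕ → ℚ
u j = recip (b j)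

X : ℕ → ℚ
X j = recip (pairSum j)

D : ℕ → ℚ
D j = X j + X (suc j) - u j

bℚ : ℕ → ℚ
bℚ j = ιℕ (b j)

tailSum-front : ∀ k N → tailSum k (suc N) ≡ term k + tailSum (suc k) N
tailSum-front k zero = cong (λ j → term k + term j) (ℕP.+-comm k 1)
tailSum-front k (suc N) = begin
  tailSum k (suc N) + term (k ℕ.+ suc (suc N))
    ≡⟨ cong (_+ term (k ℕ.+ suc (suc N))) (tailSum-front k N) ⟩
  term k + tailSum (suc k) N + term (k ℕ.+ suc (suc N))
    ≡⟨ cong (λ j → term k + tailSum (suc k) N + term j) (ℕP.+-suc k (suc N)) ⟩
  term k + tailSum (suc k) N + term (suc k ℕ.+ suc N)
    ≡⟨ ℚP.+-assoc (term k) _ _ ⟩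
  term k + (tailSum (suc k) N + term (suc k ℕ.+ suc N)) ∎
  where open ≡-Reasoning

tailSum≡sgn*alt : ∀ k N → tailSum k N ≡ sgn k * alt u k N
tailSum≡sgn*alt k zero = refl
tailSum≡sgn*alt k (suc N) = begin
  tailSum k (suc N)                             ≡⟨ tailSum-front k N ⟩
  sgn k * u k + tailSum (suc k) N               ≡⟨ cong (λ A → sgn k * u k + A) (tailSum≡sgn*alt (suc k) N) ⟩
  sgn k * u k + (- sgn k) * alt u (suc k) N     ≡⟨ factor (sgn k) (u k) (alt u (suc k) N) ⟩
  sgn k * (u k - alt u (suc k) N)               ∎
  where
  open ≡-Reasoning
  factor : ∀ σ a A → σ * a + (- σ) * A ≡ σ * (a - A)
  factor = solve-∀ ℚ-ring

tailSum-even : ∀ {n} → 2 ∣ n → ∀ N → tailSum n N ≡ alt u n N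
tailSum-even {n} 2∣n N =
  trans (tailSum≡sgn*alt n N) (trans (cong (_* alt u n N) (sgn-even 2∣n)) (ℚP.*-identityˡ (alt u n N)))

tailSum-odd : ∀ {n} → ¬ 2 ∣ n → ∀ N → tailSum n N ≡ - alt u n N
tailSum-odd {n} 2∤n N =
  trans (tailSum≡sgn*alt n N) (trans (cong (_* alt u n N) (sgn-odd 2∤n)) (-1*p≡-p (alt u n N)))

u-inverse : ∀ i → u (suc i) * bℚ (suc i) ≡ 1ℚ
u-inverse i = recip-inverse (b-pos i)

X-inverse : ∀ i → X (suc i) * (bℚ (suc i) + bℚ i) ≡ 1ℚ
X-inverse i = trans (cong (X (suc i) *_) (sym (ιℕ-+ (b (suc i)) (b i)))) (recip-inverse (pairSum-pos i))

bℚ-cassini : ∀ i → bℚ (suc i) * bℚ (suc i) ≡ bℚ i * bℚ (suc (suc i)) + ιℕ 36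
bℚ-cassini i = begin
  bℚ (suc i) * bℚ (suc i)                   ≡⟨ ιℕ-* (b (suc i)) (b (suc i)) ⟨
  ιℕ (b (suc i) ℕ.* b (suc i))              ≡⟨ cong ιℕ (b-cassini i) ⟩
  ιℕ (b i ℕ.* b (suc (suc i)) ℕ.+ 36)       ≡⟨ ιℕ-+ (b i ℕ.* b (suc (suc i))) 36 ⟩
  ιℕ (b i ℕ.* b (suc (suc i))) + ιℕ 36      ≡⟨ cong (_+ ιℕ 36) (ιℕ-* (b i) (b (suc (suc i)))) ⟩
  bℚ i * bℚ (suc (suc i)) + ιℕ 36           ∎
  where open ≡-Reasoning

D-closed : ∀ i → D (suc i) ≡ ιℕ 36 * (u (suc i) * X (suc i) * X (suc (suc i)))
D-closed i = reciprocal-defect (u (suc i)) (X (suc i)) (X (suc (suc i))) (bℚ (suc i)) (bℚ i) (bℚ (suc (suc i)))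
  (u-inverse i) (X-inverse i) (X-inverse (suc i)) (bℚ-cassini i)

u-pos : ∀ i → 0ℚ < u (suc i)
u-pos i = recip-pos (b-pos i)

X-pos : ∀ i → 0ℚ < X (suc i)
X-pos i = recip-pos (pairSum-pos i)

u-< : ∀ i → u (suc (suc i)) < u (suc i)
u-< i = recip-antimono-< (b-pos i) (b-< (suc i))

X-≤ : ∀ i → X (suc (suc i)) ≤ X (suc i)
X-≤ i = recip-antimono-≤ (pairSum-pos i) (pairSum-mono (suc i))

36-pos : 0ℚ < ιℕ 36
36-pos = ℚP.positive⁻¹ (ιℕ 36)

D-pos : ∀ i → 0ℚ < D (suc i)
D-pos i = subst (0ℚ <_) (sym (D-closed i))
  (pos*pos⇒pos 36-pos (pos*pos⇒pos (pos*pos⇒pos (u-pos i) (X-pos i)) (X-pos (suc i))))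

D-< : ∀ i → D (suc (suc i)) < D (suc i)
D-< i = subst₂ _<_ (sym (D-closed (suc i))) (sym (D-closed i)) (*-monoʳ-<-pos 36-pos
  (*-mono-<-≤ (ℚP.<⇒≤ (pos*pos⇒pos (u-pos (suc i)) (X-pos (suc i))))
              (*-mono-<-≤ (ℚP.<⇒≤ (u-pos (suc i))) (u-< i) (X-≤ i) (X-pos i))
              (X-≤ (suc i)) (X-pos (suc i))))

u-antitone : AntitoneNonNegFrom 1 u
u-antitone (suc i) _ = ℚP.<⇒≤ (u-pos i) , ℚP.<⇒≤ (u-< i)

D-antitone : AntitoneNonNegFrom 1 D
D-antitone (suc i) _ = ℚP.<⇒≤ (D-pos i) , ℚP.<⇒≤ (D-< i)

u-eventually-≤ : ∀ ε → 0ℚ < ε → Eventually (λ j → u j ≤ ε)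
u-eventually-≤ ε 0<ε = Eventually-reindex b j≤b (recip-eventually-≤ ε 0<ε)

X-eventually-≤ : ∀ ε → 0ℚ < ε → Eventually (λ j → X j ≤ ε)
X-eventually-≤ ε 0<ε = Eventually-reindex pairSum j≤pairSum (recip-eventually-≤ ε 0<ε)

D-bound : ∀ i → (ιℕ (pairSum (suc i)) + 1ℚ) * D (suc i) ≤ X (suc i) * ½
D-bound i = begin
  (q + 1ℚ) * D (suc i)                          ≡⟨ cong ((q + 1ℚ) *_) (D-closed i) ⟩
  (q + 1ℚ) * (ιℕ 36 * (υ * x * y))              ≡⟨ regroup q υ x y ⟩
  υ * y * (x * ½) * (ιℕ 72 * (q + 1ℚ))          ≤⟨ *-monoˡ-≤-nonNeg 0≤υy½x 72[q+1]≤Q[R+Q] ⟩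
  υ * y * (x * ½) * (Q * (R + Q))               ≡⟨ regroup′ υ x y Q R ⟩
  (υ * Q) * (y * (R + Q)) * (x * ½)             ≡⟨ cong₂ (λ α β → α * β * (x * ½)) (u-inverse i) (X-inverse (suc i)) ⟩
  1ℚ * 1ℚ * (x * ½)                             ≡⟨ ℚP.*-identityˡ (x * ½) ⟩
  x * ½                                         ∎
  where
  open ℚP.≤-Reasoning
  q υ x y Q R : ℚ
  q = ιℕ (pairSum (suc i))
  υ = u (suc i)
  x = X (suc i)
  y = X (suc (suc i))
  Q = bℚ (suc i)
  R = bℚ (suc (suc i))
  0≤υy½x : 0ℚ ≤ υ * y * (x * ½)
  0≤υy½x = ℚP.<⇒≤ (pos*pos⇒pos (pos*pos⇒pos (u-pos i) (X-pos (suc i))) (pos*pos⇒pos (X-pos i) (ℚP.positive⁻¹ ½)))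
  72[q+1]≤Q[R+Q] : ιℕ 72 * (q + 1ℚ) ≤ Q * (R + Q)
  72[q+1]≤Q[R+Q] = subst₂ _≤_
    (trans (ιℕ-* 72 (pairSum (suc i) ℕ.+ 1)) (cong (ιℕ 72 *_) (ιℕ-+ (pairSum (suc i)) 1)))
    (trans (ιℕ-* (b (suc i)) (pairSum (suc (suc i)))) (cong (Q *_) (ιℕ-+ (b (suc (suc i))) (b (suc i)))))
    (ιℕ-mono-≤ (pairSum-bound i))
  regroup : ∀ q υ x y → (q + 1ℚ) * (ιℕ 36 * (υ * x * y)) ≡ υ * y * (x * ½) * (ιℕ 72 * (q + 1ℚ))
  regroup = solve-∀ ℚ-ring
  regroup′ : ∀ υ x y Q R → υ * y * (x * ½) * (Q * (R + Q)) ≡ (υ * Q) * (y * (R + Q)) * (x * ½)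
  regroup′ = solve-∀ ℚ-ring

module TailEstimate (a : ℕ) where

  n : ℕ
  n = suc a

  S t : ℕ → ℚ
  S = alt u n
  t N = X (suc N ℕ.+ n)

  x q δ : ℚ
  x = X n
  q = ιℕ (pairSum n)
  δ = D n - D (suc n)

  x*q≡1 : x * q ≡ 1ℚ
  x*q≡1 = recip-inverse (pairSum-pos a)

  0<x : 0ℚ < x
  0<x = X-pos a

  0<q : 0ℚ < q
  0<q = ℚP.<-≤-trans (ℚP.positive⁻¹ 1ℚ) (ιℕ-mono-≤ {1} {pairSum n} (pairSum-pos a))

  0≤q : 0ℚ ≤ q
  0≤q = ℚP.<⇒≤ 0<q

  0≤q+1 : 0ℚ ≤ q + 1ℚ
  0≤q+1 = subst (0ℚ ≤_) (ιℕ-+ (pairSum n) 1) (ιℕ-nonNeg (pairSum n ℕ.+ 1))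

  x≤1 : x ≤ 1ℚ
  x≤1 = recip-antimono-≤ {1} (s≤s z≤n) (pairSum-pos a)

  0<δ : 0ℚ < δ
  0<δ = p<q⇒0<q-p (D-< a)

  0≤t : ∀ N → 0ℚ ≤ t N
  0≤t N = recip-nonNeg (pairSum (suc N ℕ.+ n))

  gap-identity : ∀ y z → q * (z - y) ≡ 1ℚ - q * (x + y - z)
  gap-identity y z = begin
    q * (z - y)                          ≡⟨ pad x q y z ⟩
    1ℚ - q * (x + y - z) + (x * q - 1ℚ)  ≡⟨ cong (λ w → 1ℚ - q * (x + y - z) + (w - 1ℚ)) x*q≡1 ⟩
    1ℚ - q * (x + y - z) + (1ℚ - 1ℚ)     ≡⟨ unpad (1ℚ - q * (x + y - z)) ⟩
    1ℚ - q * (x + y - z)                 ∎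
    where
    open ≡-Reasoning
    pad : ∀ x q y z → q * (z - y) ≡ 1ℚ - q * (x + y - z) + (x * q - 1ℚ)
    pad = solve-∀ ℚ-ring
    unpad : ∀ e → e + (1ℚ - 1ℚ) ≡ e
    unpad = solve-∀ ℚ-ring

  margin-identity : ∀ y z → (q + 1ℚ) * (x - y - z) - 1ℚ ≡ x - (q + 1ℚ) * y - (q + 1ℚ) * z
  margin-identity y z = begin
    (q + 1ℚ) * (x - y - z) - 1ℚ          ≡⟨ pad x q y z ⟩
    x - (q + 1ℚ) * y - (q + 1ℚ) * z + (x * q - 1ℚ)
                                         ≡⟨ cong (λ w → x - (q + 1ℚ) * y - (q + 1ℚ) * z + (w - 1ℚ)) x*q≡1 ⟩
    x - (q + 1ℚ) * y - (q + 1ℚ) * z + (1ℚ - 1ℚ)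
                                         ≡⟨ unpad (x - (q + 1ℚ) * y - (q + 1ℚ) * z) ⟩
    x - (q + 1ℚ) * y - (q + 1ℚ) * z      ∎
    where
    open ≡-Reasoning
    pad : ∀ x q y z → (q + 1ℚ) * (x - y - z) - 1ℚ ≡ x - (q + 1ℚ) * y - (q + 1ℚ) * z + (x * q - 1ℚ)
    pad = solve-∀ ℚ-ring
    unpad : ∀ e → e + (1ℚ - 1ℚ) ≡ e
    unpad = solve-∀ ℚ-ring

  S-telescoped : ∀ N → S N ≡ x + sgn N * t N - alt D n N
  S-telescoped = alt-telescope X u n

  D-antitoneₙ : AntitoneNonNegFrom n D
  D-antitoneₙ = AntitoneNonNegFrom-mono (s≤s z≤n) D-antitone

  x-t-D≤S : ∀ N → x - t (suc N) - D n ≤ S (suc N)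
  x-t-D≤S N = subst (x - t (suc N) - D n ≤_) (sym (S-telescoped (suc N)))
    (ℚP.+-mono-≤ (ℚP.+-monoʳ-≤ x (proj₁ (sgn-*-bounds (suc N) (0≤t (suc N)))))
                 (ℚP.neg-antimono-≤ (proj₂ (alt-bounds {n} {D} D-antitoneₙ (suc N)))))

  S≤x+t-δ : ∀ N → S (suc N) ≤ x + t (suc N) - δ
  S≤x+t-δ N = subst (_≤ x + t (suc N) - δ) (sym (S-telescoped (suc N)))
    (ℚP.+-mono-≤ (ℚP.+-monoʳ-≤ x (proj₂ (sgn-*-bounds (suc N) (0≤t (suc N)))))
                 (ℚP.neg-antimono-≤ (alt-lower {n} {D} D-antitoneₙ N)))

  SmallRemainder : ℕ → Set
  SmallRemainder N = 1 ℕ.≤ N × t N ≤ δ * ½ × t N ≤ x * x * ⅛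

  eventually-small : Eventually SmallRemainder
  eventually-small = Eventually-× (Eventually-≥ 1)
    (Eventually-× (t-eventually-≤ (δ * ½) (pos*pos⇒pos 0<δ (ℚP.positive⁻¹ ½)))
                  (t-eventually-≤ (x * x * ⅛) (pos*pos⇒pos (pos*pos⇒pos 0<x 0<x) (ℚP.positive⁻¹ ⅛))))
    where
    t-eventually-≤ : ∀ ε → 0ℚ < ε → Eventually (λ N → t N ≤ ε)
    t-eventually-≤ ε 0<ε = Eventually-reindex (λ N → suc N ℕ.+ n)
      (λ N → ℕP.≤-trans (ℕP.n≤1+n N) (ℕP.m≤m+n (suc N) n)) (X-eventually-≤ ε 0<ε)

  [q+1]t≤x/4 : ∀ N → t N ≤ x * x * ⅛ → (q + 1ℚ) * t N ≤ x * ¼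
  [q+1]t≤x/4 N t≤x²/8 = begin
    (q + 1ℚ) * t N                    ≤⟨ *-monoˡ-≤-nonNeg 0≤q+1 t≤x²/8 ⟩
    (q + 1ℚ) * (x * x * ⅛)            ≡⟨ expand x q ⟩
    (x * q) * x * ⅛ + x * x * ⅛       ≡⟨ cong (λ w → w * x * ⅛ + x * x * ⅛) x*q≡1 ⟩
    1ℚ * x * ⅛ + x * x * ⅛            ≤⟨ ℚP.+-monoʳ-≤ (1ℚ * x * ⅛) (*-monoʳ-≤-nonNeg (ℚP.nonNegative⁻¹ ⅛)
                                                        (*-monoˡ-≤-nonNeg (ℚP.<⇒≤ 0<x) x≤1)) ⟩
    1ℚ * x * ⅛ + x * 1ℚ * ⅛           ≡⟨ collect x ⟩
    x * ¼                             ∎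
    where
    open ℚP.≤-Reasoning
    expand : ∀ x q → (q + 1ℚ) * (x * x * ⅛) ≡ (x * q) * x * ⅛ + x * x * ⅛
    expand = solve-∀ ℚ-ring
    collect : ∀ x → 1ℚ * x * ⅛ + x * 1ℚ * ⅛ ≡ x * ¼
    collect = solve-∀ ℚ-ring

  margin : ∀ N → t N ≤ x * x * ⅛ → x * ¼ ≤ x - (q + 1ℚ) * t N - (q + 1ℚ) * D n
  margin N t≤x²/8 = begin
    x * ¼                                      ≡⟨ split x ⟩
    x - x * ¼ - x * ½                          ≤⟨ ℚP.+-mono-≤ (ℚP.+-monoʳ-≤ x (ℚP.neg-antimono-≤ ([q+1]t≤x/4 N t≤x²/8)))
                                                               (ℚP.neg-antimono-≤ (D-bound a)) ⟩
    x - (q + 1ℚ) * t N - (q + 1ℚ) * D n        ∎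
    where
    open ℚP.≤-Reasoning
    split : ∀ x → x * ¼ ≡ x - x * ¼ - x * ½
    split = solve-∀ ℚ-ring

  x/4≤S : ∀ N → SmallRemainder N → x * ¼ ≤ S N
  x/4≤S (suc N) (_ , _ , t≤x²/8) = begin
    x * ¼                                      ≤⟨ margin (suc N) t≤x²/8 ⟩
    x - (q + 1ℚ) * t (suc N) - (q + 1ℚ) * D n  ≤⟨ ℚP.+-mono-≤ (ℚP.+-monoʳ-≤ x (ℚP.neg-antimono-≤ t≤[q+1]t))
                                                               (ℚP.neg-antimono-≤ D≤[q+1]D) ⟩
    x - t (suc N) - D n                        ≤⟨ x-t-D≤S N ⟩
    S (suc N)                                  ∎
    where
    open ℚP.≤-Reasoning
    t≤[q+1]t : t (suc N) ≤ (q + 1ℚ) * t (suc N)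
    t≤[q+1]t = p≤[q+1]*p 0≤q (0≤t (suc N))
    D≤[q+1]D : D n ≤ (q + 1ℚ) * D n
    D≤[q+1]D = p≤[q+1]*p 0≤q (ℚP.<⇒≤ (D-pos a))

  qδ/2≤1-qS : ∀ N → SmallRemainder N → q * (δ * ½) ≤ 1ℚ - q * S N
  qδ/2≤1-qS (suc N) (_ , t≤δ/2 , _) = begin
    q * (δ * ½)                  ≡⟨ cong (q *_) (halve δ) ⟩
    q * (δ - δ * ½)              ≤⟨ *-monoˡ-≤-nonNeg 0≤q (ℚP.+-monoʳ-≤ δ (ℚP.neg-antimono-≤ t≤δ/2)) ⟩
    q * (δ - t (suc N))          ≡⟨ gap-identity (t (suc N)) δ ⟩
    1ℚ - q * (x + t (suc N) - δ) ≤⟨ ℚP.+-monoʳ-≤ 1ℚ (ℚP.neg-antimono-≤ (*-monoˡ-≤-nonNeg 0≤q (S≤x+t-δ N))) ⟩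
    1ℚ - q * S (suc N)           ∎
    where
    open ℚP.≤-Reasoning
    halve : ∀ δ → δ * ½ ≡ δ - δ * ½
    halve = solve-∀ ℚ-ring

  x/4≤[q+1]S-1 : ∀ N → SmallRemainder N → x * ¼ ≤ (q + 1ℚ) * S N - 1ℚ
  x/4≤[q+1]S-1 (suc N) (_ , _ , t≤x²/8) = begin
    x * ¼                                       ≤⟨ margin (suc N) t≤x²/8 ⟩
    x - (q + 1ℚ) * t (suc N) - (q + 1ℚ) * D n   ≡⟨ margin-identity (t (suc N)) (D n) ⟨
    (q + 1ℚ) * (x - t (suc N) - D n) - 1ℚ       ≤⟨ ℚP.+-monoˡ-≤ (- 1ℚ) (*-monoˡ-≤-nonNeg 0≤q+1 (x-t-D≤S N)) ⟩
    (q + 1ℚ) * S (suc N) - 1ℚ                   ∎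
    where open ℚP.≤-Reasoning

  bracketed : Bracketed q S
  bracketed = LimPos-* S-pos (q * (δ * ½) , 0<qδ/2 , Eventually-map qδ/2≤1-qS eventually-small) ,
              LimPos-* S-pos (x * ¼ , 0<x/4 , Eventually-map x/4≤[q+1]S-1 eventually-small)
    where
    0<x/4 : 0ℚ < x * ¼
    0<x/4 = pos*pos⇒pos 0<x (ℚP.positive⁻¹ ¼)
    0<qδ/2 : 0ℚ < q * (δ * ½)
    0<qδ/2 = pos*pos⇒pos 0<q (pos*pos⇒pos 0<δ (ℚP.positive⁻¹ ½))
    S-pos : LimPos S
    S-pos = x * ¼ , 0<x/4 , Eventually-map x/4≤S eventually-small

  cauchy : Cauchy S
  cauchy = alt-Cauchy (AntitoneNonNegFrom-mono (s≤s z≤n) u-antitone) u-eventually-≤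

theorem7 : ∀ (n : ℕ) → 1 ℕ.≤ n →
    (2 ∣ n → FloorInvLimit (tailSum n) (B (2 ℕ.* n) ℤ.+ B (2 ℕ.* n ∸ 2)))
    × (¬ (2 ∣ n) → FloorInvLimit (tailSum n) (ℤ.- (B (2 ℕ.* n) ℤ.+ B (2 ℕ.* n ∸ 2) ℤ.+ + 1)))
theorem7 zero ()
theorem7 (suc a) _ = even , odd
  where
  open TailEstimate a
  even : 2 ∣ suc a → FloorInvLimit (tailSum (suc a)) (B (2 ℕ.* suc a) ℤ.+ B (2 ℕ.* suc a ∸ 2))
  even 2∣n rewrite B-pairSum a =
    floorInvLimit-of-bracketed {m = + pairSum (suc a)} (tailSum-even 2∣n) cauchy bracketed
  odd : ¬ 2 ∣ suc a → FloorInvLimit (tailSum (suc a)) (ℤ.- (B (2 ℕ.* suc a) ℤ.+ B (2 ℕ.* suc a ∸ 2) ℤ.+ + 1))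
  odd 2∤n rewrite B-pairSum a =
    floorInvLimit-of-bracketed-neg {m = + pairSum (suc a)} (tailSum-odd 2∤n) cauchy bracketed
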